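{- Let $\mathbf{a},\mathbf{b},\mathbf{c}$ be weak compositions of length $n$. (1) If $\mathbf{a}\preceq\mathbf{b}$ and $\mathbf{a}\preceq\mathbf{c}$, then $\mathbf{a}\preceq\mathbf{b}\cap\mathbf{c}$. (2) If $\mathbf{a}\preceq\mathbf{c}$ and $\mathbf{b}\preceq\mathbf{c}$, then $\mathbf{a}\cup\mathbf{b}\preceq\mathbf{c}$.
   Context: A weak composition of length $n$ is a sequence $(a_1,\dots,a_n)$ of nonnegative integers. The key poset: $\mathbf{a}\preceq\mathbf{b}$ iff $a_i\le b_i$ for all $i$ and, for all $1\le i<j\le n$ with $b_j>a_j$ and $a_i>a_j$, we have $b_i>b_j$. $\mathbf{b}\cap\mathbf{c}$ and $\mathbf{a}\cup\mathbf{b}$ denote the componentwise minimum and maximum, i.e. the set-theoretic intersection and union of key diagrams (the key diagram of $\mathbf{a}$ is the set of cells $(r,c)$ with $1\le c\le a_r$). -}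

module Defs where

open import Data.Nat using (ℕ; _≤_; _<_; _⊓_; _⊔_)
open import Data.Fin using (Fin) renaming (_<_ to _<ᶠ_)
open import Data.Product using (_×_)

-- A weak composition of length n: a sequence (a_1,…,a_n) of nonnegative integers,
-- indexed by Fin n (index k stands for position k+1).
WComp : ℕ → Set
WComp n = Fin n → ℕ

_⪯_ : {n : ℕ} → WComp n → WComp n → Set
_⪯_ {n} a b =
  ((i : Fin n) → a i ≤ b i) ×
  ((i j : Fin n) → i <ᶠ j → a j < b j → a j < a i → b j < b i)

-- componentwise minimum (intersection of key diagrams)
_∩_ : {n : ℕ} → WComp n → WComp n → WComp n
(b ∩ c) i = b i ⊓ c i

-- componentwise maximum (union of key diagrams)
_∪_ : {n : ℕ} → WComp n → WComp n → WComp n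
(a ∪ b) i = a i ⊔ b i

module Submission where

open import Defs
open import Data.Nat using (ℕ; _<_; _⊔_; _<?_)
open import Data.Nat.Properties
open import Data.Product using (_×_; _,_)
open import Data.Fin using (Fin) renaming (_<_ to _<ᶠ_)
open import Data.Sum using (_⊎_; inj₁; inj₂)
open import Relation.Nullary using (yes; no; contradiction)

⊔-<-⊔⇒<⊎< : ∀ {m n o p} → m ⊔ n < o ⊔ p → m < o ⊎ n < p
⊔-<-⊔⇒<⊎< {m} {n} {o} {p} lt with m <? o | n <? p
... | yes m<o | _       = inj₁ m<o
... | no  _   | yes n<p = inj₂ n<p
... | no  m≮o | no  n≮p =
  contradiction lt (≤⇒≯ (⊔-mono-≤ (≮⇒≥ m≮o) (≮⇒≥ n≮p)))

module _ {n : ℕ} {a b c : WComp n} where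

  ⪯-∩ : a ⪯ b → a ⪯ c → a ⪯ (b ∩ c)
  ⪯-∩ (a≤b , keyᵇ) (a≤c , keyᶜ) =
    (λ i → ⊓-glb (a≤b i) (a≤c i)) ,
    λ i j i<j aⱼ<bⱼ∩cⱼ aⱼ<aᵢ → ⊓-glb
      (≤-<-trans (m⊓n≤m (b j) (c j))
        (keyᵇ i j i<j (<-≤-trans aⱼ<bⱼ∩cⱼ (m⊓n≤m (b j) (c j))) aⱼ<aᵢ))
      (≤-<-trans (m⊓n≤n (b j) (c j))
        (keyᶜ i j i<j (<-≤-trans aⱼ<bⱼ∩cⱼ (m⊓n≤n (b j) (c j))) aⱼ<aᵢ))

  -- In the key condition for a ∪ b, the strict increase from row j to row i
  -- must already occur in a or in b, whose key conditions then apply.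
  ⪯-∪ : a ⪯ c → b ⪯ c → (a ∪ b) ⪯ c
  ⪯-∪ (a≤c , keyᵃ) (b≤c , keyᵇ) =
    (λ i → ⊔-lub (a≤c i) (b≤c i)) ,
    λ i j i<j a∪bⱼ<cⱼ a∪bⱼ<a∪bᵢ → case-split i j i<j a∪bⱼ<cⱼ (⊔-<-⊔⇒<⊎< a∪bⱼ<a∪bᵢ)
    where
    case-split : (i j : Fin n) → i <ᶠ j → (a ∪ b) j < c j → a j < a i ⊎ b j < b i → c j < c i
    case-split i j i<j a∪bⱼ<cⱼ (inj₁ aⱼ<aᵢ) =
      keyᵃ i j i<j (≤-<-trans (m≤m⊔n (a j) (b j)) a∪bⱼ<cⱼ) aⱼ<aᵢ
    case-split i j i<j a∪bⱼ<cⱼ (inj₂ bⱼ<bᵢ) =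
      keyᵇ i j i<j (≤-<-trans (m≤n⊔m (a j) (b j)) a∪bⱼ<cⱼ) bⱼ<bᵢ

lemma2p7 : (n : ℕ) (a b c : WComp n) →
    ((a ⪯ b) → (a ⪯ c) → (a ⪯ (b ∩ c))) ×
    ((a ⪯ c) → (b ⪯ c) → ((a ∪ b) ⪯ c))
lemma2p7 n a b c = ⪯-∩ , ⪯-∪
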